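{- Let $S$ be a finite simplicial poset and $I\subseteq S$. Then $I$ is the independence poset of a matroid scheme on $S$ if and only if: (I1) $I$ is nonempty; (I2) if $x,y\in S$ with $x\le y$ and $y\in I$, then $x\in I$; (I3) if $x,y\in I$ and $|x|<|y|$, then there is $a\in\mathrm{at}(S)$ with $a\le y$, $a\not\le x$, and $a\vee x$ a nonempty subset of $I$; (I4) if $x,y\in S$, $z$ is a maximal element of $I_{\le x}=\{w\in I:w\le x\}$, and $z\le y$, then $x\vee y\ne\emptyset$.
   Context: A finite poset $S$ is a simplicial poset if it has a unique minimum $\hat 0$, is ranked, and each $S_{\le x}$ is isomorphic to the Boolean lattice of subsets of the set of atoms below $x$. $|x|$ is the rank of $x$, $\mathrm{at}(S)$ the set of atoms; $x\vee y$ (resp. $x\wedge y$) is the set of minimal common upper bounds (maximal common lower bounds) of $x,y$, and $x\wedge y$ also denotes its unique element when $x\vee y\neq\emptyset$. A matroid scheme on $S$ is a function $\rho:S\to\mathbb{Z}_{\ge0}$ with (M1) $0\le\rho(x)\le|x|$; (M2) $x\le y\Rightarrow\rho(x)\le\rho(y)$; (M3) $u\in x\vee y\Rightarrow\rho(x)+\rho(y)\ge\rho(u)+\rho(x\wedge y)$; (M4) $\ell\in x\wedge y$ and $\rho(x)=\rho(\ell)\Rightarrow x\vee y\ne\emptyset$; (M5) $\rho(x)<\rho(y)\Rightarrow$ there is an atom $a\le y$, $a\not\le x$, with $x\vee a\ne\emptyset$. Its independence poset is $\{x\in S:\rho(x)=|x|\}$. -}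

module Defs where

open import Data.Nat using (ℕ; zero; suc; _+_) renaming (_≤_ to _≤ℕ_; _<_ to _<ℕ_)
open import Data.Fin using (Fin)
open import Data.Fin.Subset using (Subset; _∈_; _∉_; _⊆_)
open import Data.Product using (Σ; ∃; ∃-syntax; _×_; _,_)
open import Data.Sum using (_⊎_)
open import Relation.Nullary using (¬_)
open import Relation.Binary.PropositionalEquality using (_≡_)
open import Relation.Binary.Definitions using (Decidable)
open import Relation.Binary.Structures using (IsPartialOrder)
open import Function.Bundles using (_⇔_)

-- A finite poset: carrier Fin n, order _≤_ (decidable; harmless for finite posets).
record FinitePoset : Set₁ where
  field
    n              : ℕ
    _≤_            : Fin n → Fin n → Set
    isPartialOrder : IsPartialOrder _≡_ _≤_
    _≤?_           : Decidable _≤_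

module _ (P : FinitePoset) where
  open FinitePoset P

  _<ₚ_ : Fin n → Fin n → Set
  x <ₚ y = x ≤ y × ¬ (x ≡ y)

  Covers : Fin n → Fin n → Set
  Covers x y = x <ₚ y × (∀ z → x <ₚ z → ¬ (z <ₚ y))

  IsLeast : Fin n → Set
  IsLeast z = ∀ w → z ≤ w

  IsAtom : Fin n → Set
  IsAtom a = ∃[ z ] (IsLeast z × Covers z a)

  -- u ∈ x ∨ y : u is a minimal common upper bound of x and y
  IsJoin : Fin n → Fin n → Fin n → Set
  IsJoin x y u = x ≤ u × y ≤ u × (∀ v → x ≤ v → y ≤ v → v ≤ u → v ≡ u)

  -- ℓ ∈ x ∧ y : ℓ is a maximal common lower bound of x and y
  IsMeet : Fin n → Fin n → Fin n → Set
  IsMeet x y ℓ = ℓ ≤ x × ℓ ≤ y × (∀ v → v ≤ x → v ≤ y → ℓ ≤ v → v ≡ ℓ)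

  JoinNonempty : Fin n → Fin n → Set
  JoinNonempty x y = ∃[ u ] IsJoin x y u

  -- S_{≤x} is order-isomorphic to the Boolean lattice of subsets of the set
  -- of atoms below x (subsets represented as subsets of Fin n contained in
  -- that set of atoms, ordered by inclusion).
  BooleanBelow : Fin n → Set
  BooleanBelow x =
    Σ ((y : Fin n) → y ≤ x → Subset n) λ f →
      (∀ y (p : y ≤ x) a → a ∈ f y p → IsAtom a × a ≤ x)
      × (∀ y y' (p : y ≤ x) (p' : y' ≤ x) → (y ≤ y') ⇔ (f y p ⊆ f y' p'))
      × (∀ (s : Subset n) → (∀ a → a ∈ s → IsAtom a × a ≤ x) →
           ∃[ y ] Σ (y ≤ x) λ p → f y p ≡ s)

record SimplicialPoset : Set₁ where
  field
    poset   : FinitePoset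
  open FinitePoset poset public
  field
    0̂       : Fin n
    0̂-least : IsLeast poset 0̂
    rank    : Fin n → ℕ
    rank-0̂  : rank 0̂ ≡ 0
    rank-cover : ∀ x y → Covers poset x y → rank y ≡ suc (rank x)
    boolean : ∀ x → BooleanBelow poset x

module _ (S : SimplicialPoset) where
  open SimplicialPoset S

  record IsMatroidScheme (ρ : Fin n → ℕ) : Set where
    field
      M1 : ∀ x → ρ x ≤ℕ rank x
      M2 : ∀ x y → x ≤ y → ρ x ≤ℕ ρ y
      M3 : ∀ x y u ℓ → IsJoin poset x y u → IsMeet poset x y ℓ →
             ρ u + ρ ℓ ≤ℕ ρ x + ρ y
      M4 : ∀ x y ℓ → IsMeet poset x y ℓ → ρ x ≡ ρ ℓ → JoinNonempty poset x y
      M5 : ∀ x y → ρ x <ℕ ρ y →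
             ∃[ a ] (IsAtom poset a × a ≤ y × ¬ (a ≤ x) × JoinNonempty poset x a)

  IsIndependencePosetOf : (ρ : Fin n → ℕ) → Subset n → Set
  IsIndependencePosetOf ρ I = ∀ x → (x ∈ I) ⇔ (ρ x ≡ rank x)

  I1 : Subset n → Set
  I1 I = ∃[ x ] x ∈ I

  I2 : Subset n → Set
  I2 I = ∀ x y → x ≤ y → y ∈ I → x ∈ I

  I3 : Subset n → Set
  I3 I = ∀ x y → x ∈ I → y ∈ I → rank x <ℕ rank y →
           ∃[ a ] (IsAtom poset a × a ≤ y × ¬ (a ≤ x)
                   × JoinNonempty poset a x
                   × (∀ u → IsJoin poset a x u → u ∈ I))

  MaximalBelow : Subset n → Fin n → Fin n → Set
  MaximalBelow I x z = z ∈ I × z ≤ x × (∀ w → w ∈ I → w ≤ x → z ≤ w → w ≡ z)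

  I4 : Subset n → Set
  I4 I = ∀ x y z → MaximalBelow I x z → z ≤ y → JoinNonempty poset x y

module Submission where

-- Below any w a simplicial poset is a Boolean lattice of atoms, so ranks are
-- cardinalities, joins below a common bound are unions and meets intersections.
--
-- (⇒) For (I3), walk upwards from x through elements u with ρ u = ρ x, adding
-- the atoms of y supplied by (M5) until ρ increases. Splitting off atoms one
-- at a time and applying (M3) then yields an atom c below y such that ρ
-- increases on some join v of x and c; on any other join u of c and x, ρ cannot
-- stay equal to ρ x, since (M4) would then identify u with v. (I4) is (M4)
-- applied to a common lower bound of x and y of maximal rank above z.
--
-- (⇐) Let ρ x be the largest rank of an independent element below x. By (I3),
-- independent elements below u extend to ones of rank ρ u, which gives (M3) by
-- counting atoms in x and in y; (I4) gives (M4) and, together with (I3), (M5).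

open import Defs
open import Data.Nat using (ℕ; zero; suc; _+_; _∸_; z≤n)
  renaming (_≤_ to _≤ℕ_; _<_ to _<ℕ_; _≤?_ to _≤ℕ?_; _<?_ to _<ℕ?_)
import Data.Nat.Properties as ℕ
open import Data.Nat.Induction using (<-wellFounded)
open import Induction.WellFounded using (Acc; acc)
open import Data.Fin using (Fin; _≟_)
open import Data.Fin.Properties using (any?)
open import Data.Fin.Subset
  using (Subset; inside; outside; _∈_; _∉_; _⊆_; _∪_; _∩_; _─_; _-_; ⁅_⁆; ∣_∣; Empty; Nonempty)
open import Data.Fin.Subset.Properties
  using (_∈?_; Empty-unique; ∣⊥∣≡0; nonempty?; x∈⁅x⁆; x∈⁅y⁆⇒x≡y; ∣⁅x⁆∣≡1; ∣p∣≤n; p─⊥≡p; p─q⊆p;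
         x∈p∧x≢y⇒x∈p-y; x∈p∧x∉q⇒x∈p─q; x∈p∪q⁻; x∈p∪q⁺; x∈p∩q⁻; x∈p∩q⁺;
         p⊆q⇒∣p∣≤∣q∣; p⊂q⇒∣p∣<∣q∣; ⊆-reflexive)
open import Data.Vec using (_∷_; []; here; there)
open import Data.List using (List; filter; allFin)
open import Data.List.Membership.Propositional.Properties using (∈-filter⁺; ∈-allFin)
import Data.List.Relation.Unary.All as All
open import Data.List.Relation.Unary.All.Properties using (all-filter)
open import Data.List.Extrema.Nat using (argmax; argmax-all; f[xs]≤f[argmax])
open import Data.Product using (Σ; ∃-syntax; _×_; _,_; proj₁; proj₂)
open import Data.Empty using (⊥-elim)
open import Data.Sum using (_⊎_; inj₁; inj₂; [_,_])
open import Function using (_∘_; id)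
open import Function.Bundles using (_⇔_; mk⇔; Equivalence)
open import Relation.Nullary using (¬_; Dec; yes; no)
open import Relation.Nullary.Decidable using (_×-dec_; ¬?)
open import Relation.Nullary.Negation using (contradiction)
open import Relation.Unary using (Pred; Decidable)
open import Relation.Binary.PropositionalEquality
  using (_≡_; refl; sym; trans; cong; cong₂; subst; subst₂; module ≡-Reasoning)
open import Relation.Binary.Structures using (IsPartialOrder)

private
  variable
    m : ℕ

x∈p─q⇒x∉q : ∀ {x : Fin m} (p q : Subset m) → x ∈ p ─ q → x ∉ q
x∈p─q⇒x∉q (inside ∷ p) (outside ∷ q) here      ()
x∈p─q⇒x∉q (s ∷ p)      (t ∷ q)       (there x∈) (there x∈q) = x∈p─q⇒x∉q p q x∈ x∈q

∣p∪q∣+∣p∩q∣≡∣p∣+∣q∣ : ∀ (p q : Subset m) → ∣ p ∪ q ∣ + ∣ p ∩ q ∣ ≡ ∣ p ∣ + ∣ q ∣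
∣p∪q∣+∣p∩q∣≡∣p∣+∣q∣ [] [] = refl
∣p∪q∣+∣p∩q∣≡∣p∣+∣q∣ (inside ∷ p) (inside ∷ q) = cong suc (begin
  ∣ p ∪ q ∣ + suc ∣ p ∩ q ∣   ≡⟨ ℕ.+-suc ∣ p ∪ q ∣ ∣ p ∩ q ∣ ⟩
  suc (∣ p ∪ q ∣ + ∣ p ∩ q ∣) ≡⟨ cong suc (∣p∪q∣+∣p∩q∣≡∣p∣+∣q∣ p q) ⟩
  suc (∣ p ∣ + ∣ q ∣)         ≡⟨ ℕ.+-suc ∣ p ∣ ∣ q ∣ ⟨
  ∣ p ∣ + suc ∣ q ∣           ∎)
  where open ≡-Reasoning
∣p∪q∣+∣p∩q∣≡∣p∣+∣q∣ (inside ∷ p) (outside ∷ q) = cong suc (∣p∪q∣+∣p∩q∣≡∣p∣+∣q∣ p q)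
∣p∪q∣+∣p∩q∣≡∣p∣+∣q∣ (outside ∷ p) (inside ∷ q) =
  trans (cong suc (∣p∪q∣+∣p∩q∣≡∣p∣+∣q∣ p q)) (sym (ℕ.+-suc ∣ p ∣ ∣ q ∣))
∣p∪q∣+∣p∩q∣≡∣p∣+∣q∣ (outside ∷ p) (outside ∷ q) = ∣p∪q∣+∣p∩q∣≡∣p∣+∣q∣ p q

∣p∪q∣≤∣p∣+∣q∣ : ∀ (p q : Subset m) → ∣ p ∪ q ∣ ≤ℕ ∣ p ∣ + ∣ q ∣
∣p∪q∣≤∣p∣+∣q∣ p q = subst (∣ p ∪ q ∣ ≤ℕ_) (∣p∪q∣+∣p∩q∣≡∣p∣+∣q∣ p q) (ℕ.m≤m+n _ _)

x∈p⇒∣p∣≡1+∣p-x∣ : ∀ {x : Fin m} {p : Subset m} → x ∈ p → ∣ p ∣ ≡ suc ∣ p - x ∣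
x∈p⇒∣p∣≡1+∣p-x∣ {p = inside ∷ p} here = cong (suc ∘ ∣_∣) (sym (p─⊥≡p p))
x∈p⇒∣p∣≡1+∣p-x∣ {p = inside ∷ p} (there x∈p) = cong suc (x∈p⇒∣p∣≡1+∣p-x∣ x∈p)
x∈p⇒∣p∣≡1+∣p-x∣ {p = outside ∷ p} (there x∈p) = x∈p⇒∣p∣≡1+∣p-x∣ x∈p

∣p∣≡0⇒Empty : ∀ {p : Subset m} → ∣ p ∣ ≡ 0 → Empty p
∣p∣≡0⇒Empty ∣p∣≡0 (x , x∈p) = contradiction (trans (sym ∣p∣≡0) (x∈p⇒∣p∣≡1+∣p-x∣ x∈p)) λ ()

Empty⇒∣p∣≡0 : ∀ {m} {p : Subset m} → Empty p → ∣ p ∣ ≡ 0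
Empty⇒∣p∣≡0 {m} empty = trans (cong ∣_∣ (Empty-unique empty)) (∣⊥∣≡0 m)

∣p∣≡suc⇒Nonempty : ∀ {p : Subset m} {k} → ∣ p ∣ ≡ suc k → Nonempty p
∣p∣≡suc⇒Nonempty {p = p} eq with nonempty? p
... | yes ne = ne
... | no ¬ne = contradiction (trans (sym eq) (Empty⇒∣p∣≡0 ¬ne)) λ ()

∣p∣≡1∧x∈p∧y∈p⇒y≡x : ∀ {x y : Fin m} {p : Subset m} → ∣ p ∣ ≡ 1 → x ∈ p → y ∈ p → y ≡ x
∣p∣≡1∧x∈p∧y∈p⇒y≡x {x = x} {y} {p} ∣p∣≡1 x∈p y∈p with y ≟ x
... | yes y≡x = y≡x
... | no y≢x = ⊥-elim (∣p∣≡0⇒Empty ∣p-x∣≡0 (y , x∈p∧x≢y⇒x∈p-y y∈p y≢x))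
  where
  ∣p-x∣≡0 : ∣ p - x ∣ ≡ 0
  ∣p-x∣≡0 = ℕ.suc-injective (trans (sym (x∈p⇒∣p∣≡1+∣p-x∣ x∈p)) ∣p∣≡1)

p⊈q⇒∃x∈p∖q : ∀ {p q : Subset m} → ¬ p ⊆ q → ∃[ x ] (x ∈ p × x ∉ q)
p⊈q⇒∃x∈p∖q {p = p} {q} p⊈q with any? (λ x → (x ∈? p) ×-dec ¬? (x ∈? q))
... | yes witness = witness
... | no none = contradiction (λ {x} x∈p → decide x x∈p) p⊈q
  where
  decide : ∀ x → x ∈ p → x ∈ q
  decide x x∈p with x ∈? q
  ... | yes x∈q = x∈q
  ... | no x∉q = contradiction (x , x∈p , x∉q) none

p⊆q∧q⊈p⇒∣p∣<∣q∣ : ∀ {p q : Subset m} → p ⊆ q → ¬ q ⊆ p → ∣ p ∣ <ℕ ∣ q ∣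
p⊆q∧q⊈p⇒∣p∣<∣q∣ p⊆q q⊈p = p⊂q⇒∣p∣<∣q∣ (p⊆q , p⊈q⇒∃x∈p∖q q⊈p)

module _ {ℓ} {P : Pred (Fin m) ℓ} (P? : Decidable P) (f : Fin m → ℕ) where

  ∃-maximum : ∀ {z} → P z → ∃[ x ] (P x × (∀ y → P y → f y ≤ℕ f x))
  ∃-maximum {z} Pz = argmax f z candidates , argmax-all f Pz (all-filter P? (allFin m)) , maximal
    where
    candidates : List (Fin m)
    candidates = filter P? (allFin m)
    maximal : ∀ y → P y → f y ≤ℕ f (argmax f z candidates)
    maximal y Py = All.lookup (f[xs]≤f[argmax] z candidates) (∈-filter⁺ P? (∈-allFin y) Py)

module SimplicialPosetProperties (S : SimplicialPoset) where
  open SimplicialPoset S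
  open IsPartialOrder isPartialOrder public
    using (antisym) renaming (refl to ≤-refl; trans to ≤-trans; reflexive to ≤-reflexive)

  Atom : Fin n → Set
  Atom = IsAtom poset

  _<_ : Fin n → Fin n → Set
  _<_ = _<ₚ_ poset

  Join Meet : Fin n → Fin n → Fin n → Set
  Join = IsJoin poset
  Meet = IsMeet poset

  module Below (w : Fin n) where

    atoms : ∀ y → y ≤ w → Subset n
    atoms = proj₁ (boolean w)

    atoms-mono : ∀ {y y'} (p : y ≤ w) (p' : y' ≤ w) → y ≤ y' → atoms y p ⊆ atoms y' p'
    atoms-mono {y} {y'} p p' = Equivalence.to (proj₁ (proj₂ (proj₂ (boolean w))) y y' p p')

    atoms-reflect : ∀ {y y'} (p : y ≤ w) (p' : y' ≤ w) → atoms y p ⊆ atoms y' p' → y ≤ y'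
    atoms-reflect {y} {y'} p p' = Equivalence.from (proj₁ (proj₂ (proj₂ (boolean w))) y y' p p')

    atoms-onto : ∀ {s y} (p : y ≤ w) → s ⊆ atoms y p → ∃[ y' ] Σ (y' ≤ w) λ p' → atoms y' p' ≡ s
    atoms-onto {s} p s⊆ = proj₂ (proj₂ (proj₂ (boolean w))) s λ a a∈s →
      proj₁ (proj₂ (boolean w)) w ≤-refl a (atoms-mono p ≤-refl p (s⊆ a∈s))

    Empty-atoms⇒≡0̂ : ∀ {y} (p : y ≤ w) → Empty (atoms y p) → y ≡ 0̂
    Empty-atoms⇒≡0̂ p empty = antisym
      (atoms-reflect p (0̂-least w) (λ {a} a∈ → contradiction (a , a∈) empty)) (0̂-least _)

    remove-atom-covered : ∀ {e y y'} (p : y ≤ w) (p' : y' ≤ w) →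
                          e ∈ atoms y p → atoms y' p' ≡ atoms y p - e → Covers poset y' y
    remove-atom-covered {e} {y} {y'} p p' e∈y y'≡y-e = (y'≤y , y'≢y) , nothing-between
      where
      ⊆y-e : atoms y' p' ⊆ atoms y p - e
      ⊆y-e = ⊆-reflexive y'≡y-e
      y-e⊆ : atoms y p - e ⊆ atoms y' p'
      y-e⊆ = ⊆-reflexive (sym y'≡y-e)
      e∉y' : e ∉ atoms y' p'
      e∉y' e∈ = x∈p─q⇒x∉q (atoms y p) ⁅ e ⁆ (⊆y-e e∈) (x∈⁅x⁆ e)
      y'≤y : y' ≤ y
      y'≤y = atoms-reflect p' p (p─q⊆p _ _ ∘ ⊆y-e)
      y'≢y : ¬ y' ≡ y
      y'≢y refl = e∉y' (atoms-mono p p' ≤-refl e∈y)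
      e∈z⇒y≤z : ∀ {z} (pz : z ≤ w) → y' ≤ z → e ∈ atoms z pz → y ≤ z
      e∈z⇒y≤z pz y'≤z e∈z = atoms-reflect p pz y⊆z
        where
        y⊆z : atoms y p ⊆ atoms _ pz
        y⊆z {a} a∈y with a ≟ e
        ... | yes refl = e∈z
        ... | no a≢e = atoms-mono p' pz y'≤z (y-e⊆ (x∈p∧x≢y⇒x∈p-y a∈y a≢e))
      e∉z⇒z≤y' : ∀ {z} (pz : z ≤ w) → z ≤ y → e ∉ atoms z pz → z ≤ y'
      e∉z⇒z≤y' pz z≤y e∉z = atoms-reflect pz p' λ a∈z →
        y-e⊆ (x∈p∧x≢y⇒x∈p-y (atoms-mono pz p z≤y a∈z) λ { refl → e∉z a∈z })
      nothing-between : ∀ z → y' < z → ¬ z < y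
      nothing-between z (y'≤z , y'≢z) (z≤y , z≢y) with e ∈? atoms z (≤-trans z≤y p)
      ... | yes e∈z = z≢y (antisym z≤y (e∈z⇒y≤z _ y'≤z e∈z))
      ... | no e∉z = y'≢z (antisym y'≤z (e∉z⇒z≤y' _ z≤y e∉z))

    ∣atoms∣≡rank : ∀ {y} (p : y ≤ w) → ∣ atoms y p ∣ ≡ rank y
    ∣atoms∣≡rank p = sym (count _ p refl)
      where
      count : ∀ k {y} (p : y ≤ w) → ∣ atoms y p ∣ ≡ k → rank y ≡ k
      count zero p ∣y∣≡0 = trans (cong rank (Empty-atoms⇒≡0̂ p (∣p∣≡0⇒Empty ∣y∣≡0))) rank-0̂
      count (suc k) {y} p ∣y∣≡1+k with ∣p∣≡suc⇒Nonempty ∣y∣≡1+k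
      ... | e , e∈y with atoms-onto p (p─q⊆p (atoms y p) ⁅ e ⁆)
      ...   | y' , p' , y'≡y-e = trans (rank-cover y' y (remove-atom-covered p p' e∈y y'≡y-e))
                                       (cong suc (count k p' ∣y'∣≡k))
        where
        ∣y'∣≡k : ∣ atoms y' p' ∣ ≡ k
        ∣y'∣≡k = ℕ.suc-injective (trans (cong (suc ∘ ∣_∣) y'≡y-e)
                                        (trans (sym (x∈p⇒∣p∣≡1+∣p-x∣ e∈y)) ∣y∣≡1+k))

    ∪-atoms⊆ : ∀ {x y z} (px : x ≤ w) (py : y ≤ w) (pz : z ≤ w) → x ≤ z → y ≤ z →
               atoms x px ∪ atoms y py ⊆ atoms z pz
    ∪-atoms⊆ px py pz x≤z y≤z a∈ =
      [ atoms-mono px pz x≤z , atoms-mono py pz y≤z ] (x∈p∪q⁻ (atoms _ px) (atoms _ py) a∈)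

    atoms⊆∪⇒Join : ∀ {x y j} (px : x ≤ w) (py : y ≤ w) (pj : j ≤ w) → x ≤ j → y ≤ j →
                   atoms j pj ⊆ atoms x px ∪ atoms y py → Join x y j
    atoms⊆∪⇒Join px py pj x≤j y≤j j⊆x∪y = x≤j , y≤j , λ v x≤v y≤v v≤j →
      let pv = ≤-trans v≤j pj in
      antisym v≤j (atoms-reflect pj pv (∪-atoms⊆ px py pv x≤v y≤v ∘ j⊆x∪y))

    ∩⊆atoms⇒Meet : ∀ {x y m} (px : x ≤ w) (py : y ≤ w) (pm : m ≤ w) → m ≤ x → m ≤ y →
                   atoms x px ∩ atoms y py ⊆ atoms m pm → Meet x y m
    ∩⊆atoms⇒Meet px py pm m≤x m≤y x∩y⊆m = m≤x , m≤y , λ v v≤x v≤y m≤v →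
      let pv = ≤-trans v≤x px in
      antisym (atoms-reflect pv pm λ a∈v →
                 x∩y⊆m (x∈p∩q⁺ (atoms-mono pv px v≤x a∈v , atoms-mono pv py v≤y a∈v)))
              m≤v

    join-below : ∀ {x y} (px : x ≤ w) (py : y ≤ w) →
                 ∃[ j ] Σ (j ≤ w) λ pj → Join x y j × atoms j pj ≡ atoms x px ∪ atoms y py
    join-below px py with atoms-onto ≤-refl (∪-atoms⊆ px py ≤-refl px py)
    ... | j , pj , j≡x∪y = j , pj , atoms⊆∪⇒Join px py pj x≤j y≤j (⊆-reflexive j≡x∪y) , j≡x∪y
      where
      x≤j : _ ≤ j
      x≤j = atoms-reflect px pj (⊆-reflexive (sym j≡x∪y) ∘ x∈p∪q⁺ ∘ inj₁)
      y≤j : _ ≤ j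
      y≤j = atoms-reflect py pj (⊆-reflexive (sym j≡x∪y) ∘ x∈p∪q⁺ ∘ inj₂)

    Join⇒atoms⊆∪ : ∀ {x y j} → Join x y j → (px : x ≤ w) (py : y ≤ w) (pj : j ≤ w) →
                   atoms j pj ⊆ atoms x px ∪ atoms y py
    Join⇒atoms⊆∪ (x≤j , y≤j , least) px py pj with join-below px py
    ... | j' , pj' , (x≤j' , y≤j' , _) , j'≡x∪y =
      ⊆-reflexive j'≡x∪y ∘ atoms-mono pj pj' (≤-reflexive (sym j'≡j))
      where
      j'≡j : j' ≡ _
      j'≡j = least _ x≤j' y≤j' (atoms-reflect pj' pj (∪-atoms⊆ px py pj x≤j y≤j ∘ ⊆-reflexive j'≡x∪y))

  open Below

  rank-mono : ∀ {x y} → x ≤ y → rank x ≤ℕ rank y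
  rank-mono {x} {y} x≤y = subst₂ _≤ℕ_ (∣atoms∣≡rank y x≤y) (∣atoms∣≡rank y ≤-refl)
    (p⊆q⇒∣p∣≤∣q∣ (atoms-mono y x≤y ≤-refl x≤y))

  rank-< : ∀ {x y} → x ≤ y → ¬ x ≡ y → rank x <ℕ rank y
  rank-< {x} {y} x≤y x≢y = subst₂ _<ℕ_ (∣atoms∣≡rank y x≤y) (∣atoms∣≡rank y ≤-refl)
    (p⊆q∧q⊈p⇒∣p∣<∣q∣ (atoms-mono y x≤y ≤-refl x≤y) (x≢y ∘ antisym x≤y ∘ atoms-reflect y ≤-refl x≤y))

  rank-<-witness : ∀ {x y c} → x ≤ y → c ≤ y → ¬ c ≤ x → rank x <ℕ rank y
  rank-<-witness x≤y c≤y c≰x = rank-< x≤y λ { refl → c≰x c≤y }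

  ≤∧rank≡⇒≡ : ∀ {x y} → x ≤ y → rank x ≡ rank y → x ≡ y
  ≤∧rank≡⇒≡ {x} {y} x≤y rank≡ with x ≟ y
  ... | yes x≡y = x≡y
  ... | no x≢y = contradiction rank≡ (ℕ.<⇒≢ (rank-< x≤y x≢y))

  rank≤n : ∀ x → rank x ≤ℕ n
  rank≤n x = subst (_≤ℕ n) (∣atoms∣≡rank x ≤-refl) (∣p∣≤n (atoms x x ≤-refl))

  corank : Fin n → ℕ
  corank x = n ∸ rank x

  rank<⇒corank> : ∀ {x y} → rank x <ℕ rank y → corank y <ℕ corank x
  rank<⇒corank> {y = y} rank< = ℕ.∸-monoʳ-< rank< (rank≤n y)

  atom⇒rank≡1 : ∀ {a} → Atom a → rank a ≡ 1
  atom⇒rank≡1 {a} (z , z-least , z⋖a) with antisym (z-least 0̂) (0̂-least z)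
  ... | refl = trans (rank-cover 0̂ a z⋖a) (cong suc rank-0̂)

  rank≡1⇒atom : ∀ {a} → rank a ≡ 1 → Atom a
  rank≡1⇒atom {a} rank≡1 = 0̂ , 0̂-least , (0̂-least a , 0̂≢a) , nothing-between
    where
    0̂≢a : ¬ 0̂ ≡ a
    0̂≢a refl = contradiction (trans (sym rank-0̂) rank≡1) λ ()
    nothing-between : ∀ z → 0̂ < z → ¬ z < a
    nothing-between z (0̂≤z , 0̂≢z) (z≤a , z≢a) = ℕ.<-irrefl refl (ℕ.<-≤-trans
      (subst (_<ℕ rank z) rank-0̂ (rank-< 0̂≤z 0̂≢z)) (ℕ.≤-pred (subst (rank z <ℕ_) rank≡1 (rank-< z≤a z≢a))))

  ∣atoms-atom∣≡1 : ∀ {a w} → Atom a → (p : a ≤ w) → ∣ atoms w a p ∣ ≡ 1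
  ∣atoms-atom∣≡1 a-atom p = trans (∣atoms∣≡rank _ p) (atom⇒rank≡1 a-atom)

  atom≤-of-shared-atom : ∀ {c x w e} → Atom c → (pc : c ≤ w) (px : x ≤ w) →
                         e ∈ atoms w c pc → e ∈ atoms w x px → c ≤ x
  atom≤-of-shared-atom c-atom pc px e∈c e∈x = atoms-reflect _ pc px λ a∈c →
    subst (_∈ atoms _ _ px) (sym (∣p∣≡1∧x∈p∧y∈p⇒y≡x (∣atoms-atom∣≡1 c-atom pc) e∈c a∈c)) e∈x

  Join-comm : ∀ {x y u} → Join x y u → Join y x u
  Join-comm (x≤u , y≤u , least) = y≤u , x≤u , λ v y≤v x≤v → least v x≤v y≤v

  Join≤upper-bound : ∀ {x y u b W} → Join x y u → x ≤ b → y ≤ b → u ≤ W → b ≤ W → u ≤ b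
  Join≤upper-bound {W = W} ju@(x≤u , y≤u , _) x≤b y≤b u≤W b≤W =
    atoms-reflect W u≤W b≤W (∪-atoms⊆ W px py b≤W x≤b y≤b ∘ Join⇒atoms⊆∪ W ju px py u≤W)
    where
    px : _ ≤ W
    px = ≤-trans x≤u u≤W
    py : _ ≤ W
    py = ≤-trans y≤u u≤W

  Join-unique-below : ∀ {x y u u' W} → Join x y u → Join x y u' → u ≤ W → u' ≤ W → u ≡ u'
  Join-unique-below {u = u} ju@(x≤u , y≤u , _) (x≤u' , y≤u' , least') u≤W u'≤W =
    least' u x≤u y≤u (Join≤upper-bound ju x≤u' y≤u' u≤W u'≤W)

  atom≤Join : ∀ {c x y u} → Atom c → Join x y u → c ≤ u → c ≤ x ⊎ c ≤ y
  atom≤Join {u = u} c-atom ju@(x≤u , y≤u , _) c≤u with ∣p∣≡suc⇒Nonempty (∣atoms-atom∣≡1 c-atom c≤u)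
  ... | e , e∈c with x∈p∪q⁻ _ _ (Join⇒atoms⊆∪ u ju x≤u y≤u ≤-refl (atoms-mono u c≤u ≤-refl c≤u e∈c))
  ...   | inj₁ e∈x = inj₁ (atom≤-of-shared-atom c-atom c≤u x≤u e∈c e∈x)
  ...   | inj₂ e∈y = inj₂ (atom≤-of-shared-atom c-atom c≤u y≤u e∈c e∈y)

  ≤Join-atom : ∀ {c x u t} → Atom c → Join c x u → t ≤ u → ¬ c ≤ t → t ≤ x
  ≤Join-atom {u = u} c-atom ju@(c≤u , x≤u , _) t≤u c≰t = atoms-reflect u t≤u x≤u λ a∈t →
    [ (λ a∈c → contradiction (atom≤-of-shared-atom c-atom c≤u t≤u a∈c a∈t) c≰t) , id ]
      (x∈p∪q⁻ _ _ (Join⇒atoms⊆∪ u ju c≤u x≤u ≤-refl (atoms-mono u t≤u ≤-refl t≤u a∈t)))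

  rank-Join-atom : ∀ {c x u} → Atom c → Join x c u → rank u ≤ℕ suc (rank x)
  rank-Join-atom {c} {x} {u} c-atom ju@(x≤u , c≤u , _) = begin
    rank u                                ≡⟨ ∣atoms∣≡rank u ≤-refl ⟨
    ∣ atoms u u ≤-refl ∣                  ≤⟨ p⊆q⇒∣p∣≤∣q∣ (Join⇒atoms⊆∪ u ju x≤u c≤u ≤-refl) ⟩
    ∣ atoms u x x≤u ∪ atoms u c c≤u ∣     ≤⟨ ∣p∪q∣≤∣p∣+∣q∣ (atoms u x x≤u) (atoms u c c≤u) ⟩
    ∣ atoms u x x≤u ∣ + ∣ atoms u c c≤u ∣ ≡⟨ cong₂ _+_ (∣atoms∣≡rank u x≤u) (∣atoms-atom∣≡1 c-atom c≤u) ⟩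
    rank x + 1                            ≡⟨ ℕ.+-comm (rank x) 1 ⟩
    suc (rank x)                          ∎
    where open ℕ.≤-Reasoning

  complement : ∀ {x y} → x ≤ y → ∃[ c ] (Join x c y × Meet x c 0̂ × rank x + rank c ≤ℕ rank y)
  complement {x} {y} x≤y with atoms-onto y ≤-refl (p─q⊆p (atoms y y ≤-refl) (atoms y x x≤y))
  ... | c , c≤y , c≡y─x =
    c , atoms⊆∪⇒Join y x≤y c≤y ≤-refl x≤y c≤y Y⊆X∪C
      , ∩⊆atoms⇒Meet y x≤y c≤y (0̂-least y) (0̂-least x) (0̂-least c) (λ a∈ → contradiction (_ , a∈) disjoint)
      , rank-sum
    where
    Y X C : Subset n
    Y = atoms y y ≤-refl
    X = atoms y x x≤y
    C = atoms y c c≤y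
    disjoint : Empty (X ∩ C)
    disjoint (a , a∈X∩C) with x∈p∩q⁻ X C a∈X∩C
    ... | a∈X , a∈C = x∈p─q⇒x∉q Y X (⊆-reflexive c≡y─x a∈C) a∈X
    Y⊆X∪C : Y ⊆ X ∪ C
    Y⊆X∪C {a} a∈Y with a ∈? X
    ... | yes a∈X = x∈p∪q⁺ (inj₁ a∈X)
    ... | no a∉X = x∈p∪q⁺ (inj₂ (⊆-reflexive (sym c≡y─x) (x∈p∧x∉q⇒x∈p─q a∈Y a∉X)))
    rank-sum : rank x + rank c ≤ℕ rank y
    rank-sum = begin
      rank x + rank c       ≡⟨ cong₂ _+_ (∣atoms∣≡rank y x≤y) (∣atoms∣≡rank y c≤y) ⟨
      ∣ X ∣ + ∣ C ∣         ≡⟨ ∣p∪q∣+∣p∩q∣≡∣p∣+∣q∣ X C ⟨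
      ∣ X ∪ C ∣ + ∣ X ∩ C ∣ ≡⟨ cong (∣ X ∪ C ∣ +_) (Empty⇒∣p∣≡0 disjoint) ⟩
      ∣ X ∪ C ∣ + 0         ≡⟨ ℕ.+-identityʳ _ ⟩
      ∣ X ∪ C ∣             ≤⟨ p⊆q⇒∣p∣≤∣q∣ (∪-atoms⊆ y x≤y c≤y ≤-refl x≤y c≤y) ⟩
      ∣ Y ∣                 ≡⟨ ∣atoms∣≡rank y ≤-refl ⟩
      rank y                ∎
      where open ℕ.≤-Reasoning

  rank-maximal⇒Meet : ∀ {x y ℓ} → ℓ ≤ x → ℓ ≤ y →
                      (∀ t → t ≤ x → t ≤ y → ℓ ≤ t → rank t ≤ℕ rank ℓ) → Meet x y ℓ
  rank-maximal⇒Meet ℓ≤x ℓ≤y maximal = ℓ≤x , ℓ≤y , λ t t≤x t≤y ℓ≤t →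
    sym (≤∧rank≡⇒≡ ℓ≤t (ℕ.≤-antisym (rank-mono ℓ≤t) (maximal t t≤x t≤y ℓ≤t)))

  -- w' is w with the atom t removed.
  record AtomSplitting (x w : Fin n) : Set where
    field
      t w' v    : Fin n
      t-atom    : Atom t
      t≤w       : t ≤ w
      t≰x       : ¬ t ≤ x
      w'≤w      : w' ≤ w
      x≤w'      : x ≤ w'
      rank-w'<w : rank w' <ℕ rank w
      v≤w       : v ≤ w
      v-join    : Join x t v
      w-join    : Join v w' w
      x-meet    : Meet v w' x

  split-off-atom : ∀ {x w} → x ≤ w → ¬ x ≡ w → AtomSplitting x w
  split-off-atom {x} {w} x≤w x≢w
    with p⊈q⇒∃x∈p∖q (x≢w ∘ antisym x≤w ∘ atoms-reflect w ≤-refl x≤w)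
  ... | e , e∈W , e∉X
    with atoms-onto w ≤-refl (p─q⊆p (atoms w w ≤-refl) ⁅ e ⁆)
       | atoms-onto w ≤-refl (λ a∈⁅e⁆ → subst (_∈ atoms w w ≤-refl) (sym (x∈⁅y⁆⇒x≡y e a∈⁅e⁆)) e∈W)
  ... | w' , w'≤w , W'≡W-e | t , t≤w , T≡⁅e⁆ with join-below w x≤w t≤w
  ... | v , v≤w , v-join , V≡X∪T = record
    { t = t ; w' = w' ; v = v ; t-atom = t-atom ; t≤w = t≤w ; t≰x = t≰x
    ; w'≤w = w'≤w ; x≤w' = x≤w' ; rank-w'<w = rank-< w'≤w w'≢w ; v≤w = v≤w ; v-join = v-join
    ; w-join = atoms⊆∪⇒Join w v≤w w'≤w ≤-refl v≤w w'≤w W⊆V∪W'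
    ; x-meet = ∩⊆atoms⇒Meet w v≤w w'≤w x≤w (proj₁ v-join) x≤w' V∩W'⊆X
    }
    where
    W W' X T V : Subset n
    W = atoms w w ≤-refl
    W' = atoms w w' w'≤w
    X = atoms w x x≤w
    T = atoms w t t≤w
    V = atoms w v v≤w
    e∈T : e ∈ T
    e∈T = ⊆-reflexive (sym T≡⁅e⁆) (x∈⁅x⁆ e)
    e∉W' : e ∉ W'
    e∉W' e∈W' = x∈p─q⇒x∉q W ⁅ e ⁆ (⊆-reflexive W'≡W-e e∈W') (x∈⁅x⁆ e)
    t-atom : Atom t
    t-atom = rank≡1⇒atom (trans (sym (∣atoms∣≡rank w t≤w)) (trans (cong ∣_∣ T≡⁅e⁆) (∣⁅x⁆∣≡1 e)))
    t≰x : ¬ t ≤ x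
    t≰x t≤x = e∉X (atoms-mono w t≤w x≤w t≤x e∈T)
    x≤w' : x ≤ w'
    x≤w' = atoms-reflect w x≤w w'≤w λ {a} a∈X →
      ⊆-reflexive (sym W'≡W-e) (x∈p∧x≢y⇒x∈p-y (atoms-mono w x≤w ≤-refl x≤w a∈X) λ { refl → e∉X a∈X })
    w'≢w : ¬ w' ≡ w
    w'≢w refl = e∉W' (atoms-mono w ≤-refl w'≤w ≤-refl e∈W)
    W⊆V∪W' : W ⊆ V ∪ W'
    W⊆V∪W' {a} a∈W with a ≟ e
    ... | yes refl = x∈p∪q⁺ (inj₁ (atoms-mono w t≤w v≤w (proj₁ (proj₂ v-join)) e∈T))
    ... | no a≢e = x∈p∪q⁺ (inj₂ (⊆-reflexive (sym W'≡W-e) (x∈p∧x≢y⇒x∈p-y a∈W a≢e)))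
    V∩W'⊆X : V ∩ W' ⊆ X
    V∩W'⊆X {a} a∈V∩W' with x∈p∩q⁻ V W' a∈V∩W'
    ... | a∈V , a∈W' with x∈p∪q⁻ X T (⊆-reflexive V≡X∪T a∈V)
    ...   | inj₁ a∈X = a∈X
    ...   | inj₂ a∈T with x∈⁅y⁆⇒x≡y e (⊆-reflexive T≡⁅e⁆ a∈T)
    ...     | refl = contradiction a∈W' e∉W'

module SchemeToIndependence (S : SimplicialPoset) (ρ : Fin (SimplicialPoset.n S) → ℕ)
                            (M : IsMatroidScheme S ρ) (I : Subset (SimplicialPoset.n S))
                            (I≡indep : IsIndependencePosetOf S ρ I) where
  open SimplicialPoset S
  open SimplicialPosetProperties S
  open IsMatroidScheme M

  ∈I⇒ρ≡rank : ∀ {x} → x ∈ I → ρ x ≡ rank x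
  ∈I⇒ρ≡rank {x} = Equivalence.to (I≡indep x)

  rank≤ρ⇒∈I : ∀ {x} → rank x ≤ℕ ρ x → x ∈ I
  rank≤ρ⇒∈I {x} rank≤ρ = Equivalence.from (I≡indep x) (ℕ.≤-antisym (M1 x) rank≤ρ)

  ≤∧ρ≮⇒ρ≡ : ∀ {x y} → x ≤ y → ¬ ρ x <ℕ ρ y → ρ y ≡ ρ x
  ≤∧ρ≮⇒ρ≡ x≤y ρx≮ρy = ℕ.≤-antisym (ℕ.≮⇒≥ ρx≮ρy) (M2 _ _ x≤y)

  nonempty : I1 S I
  nonempty = 0̂ , rank≤ρ⇒∈I (subst (_≤ℕ ρ 0̂) (sym rank-0̂) z≤n)

  downward-closed : I2 S I
  downward-closed x y x≤y y∈I with complement x≤y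
  ... | c , y-join , 0̂-meet , rank-sum = rank≤ρ⇒∈I (ℕ.+-cancelʳ-≤ (rank c) (rank x) (ρ x) (begin
    rank x + rank c ≤⟨ rank-sum ⟩
    rank y          ≡⟨ ∈I⇒ρ≡rank y∈I ⟨
    ρ y             ≤⟨ ℕ.m≤m+n (ρ y) (ρ 0̂) ⟩
    ρ y + ρ 0̂       ≤⟨ M3 x c y 0̂ y-join 0̂-meet ⟩
    ρ x + ρ c       ≤⟨ ℕ.+-monoʳ-≤ (ρ x) (M1 c) ⟩
    ρ x + rank c    ∎))
    where open ℕ.≤-Reasoning

  AugmentingAtom : Fin n → Fin n → Set
  AugmentingAtom w x = ∃[ c ] (Atom c × c ≤ w × ¬ c ≤ x × ∃[ v ] (v ≤ w × Join x c v × ρ x <ℕ ρ v))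

  AugmentingAtom-mono : ∀ {x w w'} → w' ≤ w → AugmentingAtom w' x → AugmentingAtom w x
  AugmentingAtom-mono w'≤w (c , c-atom , c≤w' , c≰x , v , v≤w' , v-join , ρx<ρv) =
    c , c-atom , ≤-trans c≤w' w'≤w , c≰x , v , ≤-trans v≤w' w'≤w , v-join , ρx<ρv

  augmenting-atom : ∀ {x w} → x ≤ w → ρ x <ℕ ρ w → AugmentingAtom w x
  augmenting-atom {x} {w} = search w (<-wellFounded (rank w))
    where
    search : ∀ w → Acc _<ℕ_ (rank w) → x ≤ w → ρ x <ℕ ρ w → AugmentingAtom w x
    search w (acc smaller) x≤w ρx<ρw = from-splitting s (ρ x <ℕ? ρ (AtomSplitting.w' s))
      where
      s = split-off-atom x≤w λ { refl → ℕ.<-irrefl refl ρx<ρw }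
      from-splitting : (s : AtomSplitting x w) → Dec (ρ x <ℕ ρ (AtomSplitting.w' s)) → AugmentingAtom w x
      from-splitting s (yes ρx<ρw') =
        AugmentingAtom-mono w'≤w (search w' (smaller rank-w'<w) x≤w' ρx<ρw')
        where open AtomSplitting s
      from-splitting s (no ρx≮ρw') = t , t-atom , t≤w , t≰x , v , v≤w , v-join , ℕ.<-≤-trans ρx<ρw ρw≤ρv
        where
        open AtomSplitting s
        ρw≤ρv : ρ w ≤ℕ ρ v
        ρw≤ρv = ℕ.+-cancelʳ-≤ (ρ x) (ρ w) (ρ v)
          (subst (λ k → ρ w + ρ x ≤ℕ ρ v + k) (≤∧ρ≮⇒ρ≡ x≤w' ρx≮ρw') (M3 v w' w x w-join x-meet))

  Join-atom-∈I : ∀ {c x v} → Atom c → Join x c v → x ∈ I → ρ x <ℕ ρ v → v ∈ I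
  Join-atom-∈I {v = v} c-atom v-join x∈I ρx<ρv = rank≤ρ⇒∈I (ℕ.≤-trans (rank-Join-atom c-atom v-join)
    (subst (λ k → suc k ≤ℕ ρ v) (∈I⇒ρ≡rank x∈I) ρx<ρv))

  -- If ρ u = ρ x, then x = u ∧ v and (M4) gives u and v a common upper bound,
  -- below which the two joins u and v of c and x must coincide.
  every-Join-atom-∈I : ∀ {c x v u} → Atom c → x ∈ I → Join x c v → ρ x <ℕ ρ v → Join c x u → u ∈ I
  every-Join-atom-∈I {c} {x} {v} {u} c-atom x∈I v-join@(x≤v , c≤v , v-least) ρx<ρv
                     u-join@(c≤u , x≤u , u-least) = decide (ρ x <ℕ? ρ u)
    where
    u≢v : ρ u ≡ ρ x → ¬ u ≡ v
    u≢v ρu≡ρx refl = ℕ.<-irrefl (sym ρu≡ρx) ρx<ρv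
    x-meet : ¬ u ≡ v → Meet u v x
    x-meet u≢v = x≤u , x≤v , λ t t≤u t≤v x≤t → bound t t≤u t≤v x≤t (c ≤? t)
      where
      bound : ∀ t → t ≤ u → t ≤ v → x ≤ t → Dec (c ≤ t) → t ≡ x
      bound t t≤u t≤v x≤t (yes c≤t) with u-least t c≤t x≤t t≤u
      ... | refl = contradiction (v-least u x≤u c≤u t≤v) u≢v
      bound t t≤u t≤v x≤t (no c≰t) = antisym (≤Join-atom c-atom u-join t≤u c≰t) x≤t
    decide : Dec (ρ x <ℕ ρ u) → u ∈ I
    decide (yes ρx<ρu) = Join-atom-∈I c-atom (Join-comm u-join) x∈I ρx<ρu
    decide (no ρx≮ρu) =
      let ρu≡ρx = ≤∧ρ≮⇒ρ≡ x≤u ρx≮ρu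
          (W , u≤W , v≤W , _) = M4 u v x (x-meet (u≢v ρu≡ρx)) ρu≡ρx
      in contradiction (Join-unique-below (Join-comm u-join) v-join u≤W v≤W) (u≢v ρu≡ρx)

  exchange : I3 S I
  exchange x y x∈I y∈I rank-x<y = climb x (<-wellFounded (corank x)) ≤-refl (∈I⇒ρ≡rank x∈I)
    where
    ρ≡rank-x : ρ x ≡ rank x
    ρ≡rank-x = ∈I⇒ρ≡rank x∈I
    Goal : Set
    Goal = ∃[ a ] (Atom a × a ≤ y × ¬ a ≤ x × JoinNonempty poset a x × (∀ u → Join a x u → u ∈ I))

    augment : ∀ {u b w} → x ≤ u → ρ u ≡ rank x → Atom b → b ≤ y → Join u b w → ρ u <ℕ ρ w → Goal
    augment {u} {b} {w} x≤u ρu≡ b-atom b≤y w-join@(u≤w , b≤w , _) ρu<ρw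
      with augmenting-atom (≤-trans x≤u u≤w) (subst (_<ℕ ρ w) (trans ρu≡ (sym ρ≡rank-x)) ρu<ρw)
    ... | c , c-atom , c≤w , c≰x , v , v≤w , v-join , ρx<ρv =
      c , c-atom , ≤-trans c≤b b≤y , c≰x , (v , Join-comm v-join) ,
      λ _ → every-Join-atom-∈I c-atom x∈I v-join ρx<ρv
      where
      c≰u : ¬ c ≤ u
      c≰u c≤u = ℕ.<-irrefl refl (ℕ.<-≤-trans ρx<ρv (begin
        ρ v ≤⟨ M2 v u (Join≤upper-bound v-join x≤u c≤u v≤w u≤w) ⟩
        ρ u ≡⟨ trans ρu≡ (sym ρ≡rank-x) ⟩
        ρ x ∎))
        where open ℕ.≤-Reasoning
      c≤b : c ≤ b
      c≤b with atom≤Join c-atom w-join c≤w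
      ... | inj₁ c≤u = contradiction c≤u c≰u
      ... | inj₂ c≤b = c≤b

    climb : ∀ u → Acc _<ℕ_ (corank u) → x ≤ u → ρ u ≡ rank x → Goal
    climb u (acc larger) x≤u ρu≡ with M5 u y (subst₂ _<ℕ_ (sym ρu≡) (sym (∈I⇒ρ≡rank y∈I)) rank-x<y)
    ... | b , b-atom , b≤y , b≰u , w , w-join@(u≤w , b≤w , _) with ρ u <ℕ? ρ w
    ...   | yes ρu<ρw = augment x≤u ρu≡ b-atom b≤y w-join ρu<ρw
    ...   | no ρu≮ρw = climb w (larger (rank<⇒corank> (rank-<-witness u≤w b≤w b≰u)))
                          (≤-trans x≤u u≤w) (trans (≤∧ρ≮⇒ρ≡ u≤w ρu≮ρw) ρu≡)

  joinable : I4 S I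
  joinable x y z (z∈I , z≤x , z-maximal) z≤y
    with ∃-maximum (λ t → (t ≤? x) ×-dec ((t ≤? y) ×-dec (z ≤? t))) rank (z≤x , z≤y , ≤-refl)
  ... | ℓ , (ℓ≤x , ℓ≤y , z≤ℓ) , ℓ-maximal = M4 x y ℓ ℓ-meet ρx≡ρℓ
    where
    ρx≡ρz : ρ x ≡ ρ z
    ρx≡ρz with ρ z <ℕ? ρ x
    ... | no ρz≮ρx = ≤∧ρ≮⇒ρ≡ z≤x ρz≮ρx
    ... | yes ρz<ρx with augmenting-atom z≤x ρz<ρx
    ...   | c , c-atom , _ , _ , v , v≤x , v-join@(z≤v , _ , _) , ρz<ρv =
      contradiction (cong ρ (z-maximal v (Join-atom-∈I c-atom v-join z∈I ρz<ρv) v≤x z≤v))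
                    (ℕ.<⇒≢ ρz<ρv ∘ sym)
    ℓ-meet : Meet x y ℓ
    ℓ-meet = rank-maximal⇒Meet ℓ≤x ℓ≤y λ t t≤x t≤y ℓ≤t → ℓ-maximal t (t≤x , t≤y , ≤-trans z≤ℓ ℓ≤t)
    ρx≡ρℓ : ρ x ≡ ρ ℓ
    ρx≡ρℓ = ℕ.≤-antisym (subst (_≤ℕ ρ ℓ) (sym ρx≡ρz) (M2 z ℓ z≤ℓ)) (M2 ℓ x ℓ≤x)

module IndependenceToScheme (S : SimplicialPoset) (I : Subset (SimplicialPoset.n S))
                            (nonempty : I1 S I) (downward-closed : I2 S I)
                            (exchange : I3 S I) (joinable : I4 S I) where
  open SimplicialPoset S
  open SimplicialPosetProperties S
  open Below

  0̂∈I : 0̂ ∈ I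
  0̂∈I = downward-closed 0̂ (proj₁ nonempty) (0̂-least _) (proj₂ nonempty)

  basis-of : ∀ x → ∃[ b ] ((b ∈ I × b ≤ x) × (∀ t → t ∈ I × t ≤ x → rank t ≤ℕ rank b))
  basis-of x = ∃-maximum (λ t → (t ∈? I) ×-dec (t ≤? x)) rank (0̂∈I , 0̂-least x)

  basis : Fin n → Fin n
  basis x = proj₁ (basis-of x)

  basis∈I : ∀ x → basis x ∈ I
  basis∈I x = proj₁ (proj₁ (proj₂ (basis-of x)))

  basis≤ : ∀ x → basis x ≤ x
  basis≤ x = proj₂ (proj₁ (proj₂ (basis-of x)))

  ρ : Fin n → ℕ
  ρ x = rank (basis x)

  rank≤ρ : ∀ {t x} → t ∈ I → t ≤ x → rank t ≤ℕ ρ x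
  rank≤ρ {t} {x} t∈I t≤x = proj₂ (proj₂ (basis-of x)) t (t∈I , t≤x)

  rank≡ρ⇒MaximalBelow : ∀ {x z} → z ∈ I → z ≤ x → rank z ≡ ρ x → MaximalBelow S I x z
  rank≡ρ⇒MaximalBelow z∈I z≤x rank-z≡ρx = z∈I , z≤x , λ t t∈I t≤x z≤t →
    sym (≤∧rank≡⇒≡ z≤t (ℕ.≤-antisym (rank-mono z≤t) (subst (rank t ≤ℕ_) (sym rank-z≡ρx) (rank≤ρ t∈I t≤x))))

  basis-maximal : ∀ x → MaximalBelow S I x (basis x)
  basis-maximal x = rank≡ρ⇒MaximalBelow (basis∈I x) (basis≤ x) refl

  is-independence-poset : IsIndependencePosetOf S ρ I
  is-independence-poset x = mk⇔
    (λ x∈I → ℕ.≤-antisym (rank-mono (basis≤ x)) (rank≤ρ x∈I ≤-refl))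
    (λ ρx≡rank → subst (_∈ I) (≤∧rank≡⇒≡ (basis≤ x) ρx≡rank) (basis∈I x))

  ρ≤rank : ∀ x → ρ x ≤ℕ rank x
  ρ≤rank x = rank-mono (basis≤ x)

  ρ-mono : ∀ x y → x ≤ y → ρ x ≤ℕ ρ y
  ρ-mono x y x≤y = rank≤ρ (basis∈I x) (≤-trans (basis≤ x) x≤y)

  ρ-flat-meet⇒joinable : ∀ x y ℓ → Meet x y ℓ → ρ x ≡ ρ ℓ → JoinNonempty poset x y
  ρ-flat-meet⇒joinable x y ℓ (ℓ≤x , ℓ≤y , _) ρx≡ρℓ =
    joinable x y (basis ℓ) (rank≡ρ⇒MaximalBelow (basis∈I ℓ) (≤-trans (basis≤ ℓ) ℓ≤x) (sym ρx≡ρℓ))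
             (≤-trans (basis≤ ℓ) ℓ≤y)

  ρ-augmentation : ∀ x y → ρ x <ℕ ρ y →
                   ∃[ a ] (Atom a × a ≤ y × ¬ a ≤ x × JoinNonempty poset x a)
  ρ-augmentation x y ρx<ρy with exchange (basis x) (basis y) (basis∈I x) (basis∈I y) ρx<ρy
  ... | a , a-atom , a≤by , a≰bx , (u , u-join@(a≤u , bx≤u , _)) , joins∈I =
    a , a-atom , ≤-trans a≤by (basis≤ y) , a≰x , x∨a
    where
    a≰x : ¬ a ≤ x
    a≰x a≤x with join-below x a≤x (basis≤ x)
    ... | j , j≤x , j-join@(a≤j , bx≤j , _) , _ = ℕ.<-irrefl refl
      (ℕ.<-≤-trans (rank-<-witness bx≤j a≤j a≰bx) (rank≤ρ (joins∈I j j-join) j≤x))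
    x∨a : JoinNonempty poset x a
    x∨a with joinable x u (basis x) (basis-maximal x) bx≤u
    ... | W , x≤W , u≤W , _ with join-below W x≤W (≤-trans a≤u u≤W)
    ...   | j , _ , j-join , _ = j , j-join

  extend-to-basis : ∀ {z u} → z ∈ I → z ≤ u → ∃[ b ] (b ∈ I × z ≤ b × b ≤ u × rank b ≡ ρ u)
  extend-to-basis {z} {u} = extend z (<-wellFounded (corank z))
    where
    extend : ∀ z → Acc _<ℕ_ (corank z) → z ∈ I → z ≤ u → ∃[ b ] (b ∈ I × z ≤ b × b ≤ u × rank b ≡ ρ u)
    extend z (acc larger) z∈I z≤u with ρ u ≤ℕ? rank z
    ... | yes ρu≤rank-z = z , z∈I , ≤-refl , z≤u , ℕ.≤-antisym (rank≤ρ z∈I z≤u) ρu≤rank-z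
    ... | no ρu≰rank-z with exchange z (basis u) z∈I (basis∈I u) (ℕ.≰⇒> ρu≰rank-z)
    ...   | a , a-atom , a≤bu , a≰z , _ , joins∈I with join-below u (≤-trans a≤bu (basis≤ u)) z≤u
    ...     | j , j≤u , j-join@(a≤j , z≤j , _) , _
      with extend j (larger (rank<⇒corank> (rank-<-witness z≤j a≤j a≰z))) (joins∈I j j-join) j≤u
    ...       | b , b∈I , j≤b , b≤u , rank-b≡ρu = b , b∈I , ≤-trans z≤j j≤b , b≤u , rank-b≡ρu

  ∣atoms∩∣≤ρ : ∀ {b x u} → b ∈ I → (b≤u : b ≤ u) (x≤u : x ≤ u) →
               ∣ atoms u b b≤u ∩ atoms u x x≤u ∣ ≤ℕ ρ x
  ∣atoms∩∣≤ρ {b} {x} {u} b∈I b≤u x≤u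
    with atoms-onto u b≤u (λ a∈ → proj₁ (x∈p∩q⁻ (atoms u b b≤u) (atoms u x x≤u) a∈))
  ... | m , m≤u , m≡b∩x = subst (_≤ℕ ρ x) (trans (sym (∣atoms∣≡rank u m≤u)) (cong ∣_∣ m≡b∩x))
    (rank≤ρ (downward-closed m b m≤b b∈I) m≤x)
    where
    m≤b : m ≤ b
    m≤b = atoms-reflect u m≤u b≤u (proj₁ ∘ x∈p∩q⁻ _ _ ∘ ⊆-reflexive m≡b∩x)
    m≤x : m ≤ x
    m≤x = atoms-reflect u m≤u x≤u (proj₂ ∘ x∈p∩q⁻ _ _ ∘ ⊆-reflexive m≡b∩x)

  -- Extend a basis z of ℓ to a basis b of u and count the atoms of b inside x and y.
  ρ-submodular : ∀ x y u ℓ → Join x y u → Meet x y ℓ → ρ u + ρ ℓ ≤ℕ ρ x + ρ y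
  ρ-submodular x y u ℓ u-join@(x≤u , y≤u , _) (ℓ≤x , ℓ≤y , _)
    with extend-to-basis (basis∈I ℓ) (≤-trans (basis≤ ℓ) (≤-trans ℓ≤x x≤u))
  ... | b , b∈I , z≤b , b≤u , rank-b≡ρu = begin
    ρ u + ρ ℓ             ≡⟨ cong₂ _+_ (trans (∣atoms∣≡rank u b≤u) rank-b≡ρu) (∣atoms∣≡rank u z≤u) ⟨
    ∣ B ∣ + ∣ Z ∣         ≤⟨ ℕ.+-mono-≤ (p⊆q⇒∣p∣≤∣q∣ B⊆P∪Q) (p⊆q⇒∣p∣≤∣q∣ Z⊆P∩Q) ⟩
    ∣ P ∪ Q ∣ + ∣ P ∩ Q ∣ ≡⟨ ∣p∪q∣+∣p∩q∣≡∣p∣+∣q∣ P Q ⟩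
    ∣ P ∣ + ∣ Q ∣         ≤⟨ ℕ.+-mono-≤ (∣atoms∩∣≤ρ b∈I b≤u x≤u) (∣atoms∩∣≤ρ b∈I b≤u y≤u) ⟩
    ρ x + ρ y             ∎
    where
    open ℕ.≤-Reasoning
    z : Fin n
    z = basis ℓ
    z≤u : z ≤ u
    z≤u = ≤-trans (basis≤ ℓ) (≤-trans ℓ≤x x≤u)
    B Z P Q : Subset n
    B = atoms u b b≤u
    Z = atoms u z z≤u
    P = B ∩ atoms u x x≤u
    Q = B ∩ atoms u y y≤u
    B⊆P∪Q : B ⊆ P ∪ Q
    B⊆P∪Q a∈B with x∈p∪q⁻ _ _ (Join⇒atoms⊆∪ u u-join x≤u y≤u ≤-refl (atoms-mono u b≤u ≤-refl b≤u a∈B))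
    ... | inj₁ a∈X = x∈p∪q⁺ (inj₁ (x∈p∩q⁺ (a∈B , a∈X)))
    ... | inj₂ a∈Y = x∈p∪q⁺ (inj₂ (x∈p∩q⁺ (a∈B , a∈Y)))
    Z⊆P∩Q : Z ⊆ P ∩ Q
    Z⊆P∩Q a∈Z = x∈p∩q⁺ ( x∈p∩q⁺ (a∈B , atoms-mono u z≤u x≤u (≤-trans (basis≤ ℓ) ℓ≤x) a∈Z)
                       , x∈p∩q⁺ (a∈B , atoms-mono u z≤u y≤u (≤-trans (basis≤ ℓ) ℓ≤y) a∈Z))
      where
      a∈B : _ ∈ B
      a∈B = atoms-mono u z≤u b≤u z≤b a∈Z

  is-matroid-scheme : IsMatroidScheme S ρ
  is-matroid-scheme = record
    { M1 = ρ≤rank ; M2 = ρ-mono ; M3 = ρ-submodular ; M4 = ρ-flat-meet⇒joinable ; M5 = ρ-augmentation }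

theorem6p2 : (S : SimplicialPoset) (I : Subset (SimplicialPoset.n S)) →
    (Σ (Fin (SimplicialPoset.n S) → ℕ) λ ρ → IsMatroidScheme S ρ × IsIndependencePosetOf S ρ I)
    ⇔ (I1 S I × I2 S I × I3 S I × I4 S I)
theorem6p2 S I = mk⇔
  (λ { (ρ , scheme , I≡indep) →
         let open SchemeToIndependence S ρ scheme I I≡indep
         in nonempty , downward-closed , exchange , joinable })
  (λ { (i1 , i2 , i3 , i4) →
         let open IndependenceToScheme S I i1 i2 i3 i4
         in ρ , is-matroid-scheme , is-independence-poset })
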